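{- Consider the operation $pr$ on $A\cup M$. Then: (i) for all $x,y\in M$, $pr(x)=pr(y)$ implies $x=y$; (ii) for all $x,y\in M$, $x\subseteq y$ if and only if $pr(x)\subseteq pr(y)$; (iii) for all $a\in A$ and $x\in M$, $pr(a)\neq pr(x)$; (iv) for all $a,b\in A$, $pr(a)=pr(b)$ if and only if $a\preccurlyeq b$ and $b\preccurlyeq a$.
   Context: Work in ZFA, i.e. ZF with a set $A$ of atoms. Fix a preorder $\preccurlyeq$ on $A$ with no minimal elements: for every $a\in A$ there is $b\in A$ with $b\preccurlyeq a$ and $a\not\preccurlyeq b$. For $a\in A$ let $pr(a)=\{b\in A: b\preccurlyeq a\}$. Define the magmatic hierarchy: $M_1$ is the set of nonempty subsets $x\subseteq A$ that are downward closed ($a\in x$ and $b\preccurlyeq a$ imply $b\in x$); for $\alpha\geq 1$, $M_{\alpha+1}$ is the set of nonempty $x\subseteq M_\alpha$ such that for every $y\in x$, every $z\in M_\alpha$ with $z\subseteq y$ belongs to $x$; $M_\lambda=\bigcup_{1\leq\beta<\lambda}M_\beta$ for limit $\lambda$; $M=\bigcup_{\alpha\geq1}M_\alpha$ (elements of $M$ are called magmas). For $x\in M$ let $pr(x)=\mathcal{P}(x)\cap M=\{y\in M:y\subseteq x\}$. -}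

module Defs where

open import Level using (Lift; lift) renaming (suc to lsuc; zero to lzero)
open import Data.Product using (Σ; Σ-syntax; _×_; _,_)
open import Data.Sum using (_⊎_)
open import Data.Empty using (⊥)
open import Data.Unit using (⊤)
open import Relation.Binary.PropositionalEquality using (_≡_)

-- A universe of ZFA-style sets with atoms, in the style of Aczel's
-- well-founded set trees (atoms from the type A), with extensional equality.
module ZFA (A : Set) (_≼_ : A → A → Set) where

  data V : Set₁ where
    atom : A → V
    sup  : (I : Set) → (I → V) → V

  _≐_ : V → V → Set
  atom a  ≐ atom b  = a ≡ b
  atom _  ≐ sup _ _ = ⊥
  sup _ _ ≐ atom _  = ⊥
  sup I f ≐ sup J g =
    ((i : I) → Σ[ j ∈ J ] (f i ≐ g j)) × ((j : J) → Σ[ i ∈ I ] (f i ≐ g j))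

  _∈_ : V → V → Set
  x ∈ atom _  = ⊥
  x ∈ sup I f = Σ[ i ∈ I ] (x ≐ f i)

  _⊆_ : V → V → Set₁
  x ⊆ y = (z : V) → z ∈ x → z ∈ y

  IsSet : V → Set
  IsSet (atom _)  = ⊥
  IsSet (sup _ _) = ⊤

  Nonempty : V → Set₁
  Nonempty x = Σ[ z ∈ V ] (z ∈ x)

  M₁ : V → Set₁
  M₁ x = IsSet x × Nonempty x
       × ((z : V) → z ∈ x → Σ[ a ∈ A ] (z ≐ atom a))
       × ((a b : A) → atom a ∈ x → b ≼ a → atom b ∈ x)

  Next : (V → Set₁) → V → Set₁
  Next P x = IsSet x × Nonempty x
           × ((z : V) → z ∈ x → P z)
           × ((y z : V) → y ∈ x → P z → z ⊆ y → z ∈ x)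

  -- Ordinals ≥ 1 as Brouwer trees: one, successor, supremum of a family
  data Ord : Set₁ where
    one  : Ord
    succ : Ord → Ord
    lim  : (I : Set) → (I → Ord) → Ord

  data _≤ᴼ_ : Ord → Ord → Set₁ where
    ≤-one      : ∀ {x} → one ≤ᴼ x
    ≤-refl     : ∀ {x} → x ≤ᴼ x
    ≤-trans    : ∀ {x y z} → x ≤ᴼ y → y ≤ᴼ z → x ≤ᴼ z
    ≤-succ     : ∀ {x y} → x ≤ᴼ y → succ x ≤ᴼ succ y
    ≤-cocone   : ∀ {x I f} (k : I) → x ≤ᴼ f k → x ≤ᴼ lim I f
    ≤-limiting : ∀ {x I f} → ((k : I) → f k ≤ᴼ x) → lim I f ≤ᴼ x

  _<ᴼ_ : Ord → Ord → Set₁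
  x <ᴼ y = succ x ≤ᴼ y

  -- well-formed trees: every `lim` node is a genuine limit ordinal
  -- (nonempty family with no largest element)
  WF : Ord → Set₁
  WF one       = Lift _ ⊤
  WF (succ α)  = WF α
  WF (lim I f) = I × ((i : I) → WF (f i))
               × ((i : I) → Σ[ j ∈ I ] (f i <ᴼ f j))

  -- Lev α = M_α ;  Upto α = ⋃_{1 ≤ β ≤ α} M_β
  Lev  : Ord → V → Set₁
  Upto : Ord → V → Set₁
  Lev one       x = M₁ x
  Lev (succ α)  x = Next (Lev α) x
  Lev (lim I f) x = Σ[ i ∈ I ] Upto (f i) x    -- M_λ = ⋃_{β<λ} M_β
  Upto one       x = M₁ x
  Upto (succ α)  x = Upto α x ⊎ Next (Lev α) x
  Upto (lim I f) x = Lev (lim I f) x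

  -- magmas: M = ⋃_{α ≥ 1} M_α
  IsMagma : V → Set₁
  IsMagma x = Σ[ α ∈ Ord ] (WF α × Lev α x)

  -- the operation pr on A ∪ M, as a class (predicate on V):
  --   pr(a) = {b ∈ A : b ≼ a},  pr(x) = P(x) ∩ M
  pr : V → V → Set₁
  pr (atom a)  w = Σ[ b ∈ A ] (Lift (lsuc lzero) (w ≐ atom b) × Lift (lsuc lzero) (b ≼ a))
  pr (sup I f) w = IsMagma w × (w ⊆ sup I f)

  _≡ᶜ_ : (V → Set₁) → (V → Set₁) → Set₁
  P ≡ᶜ Q = (w : V) → (P w → Q w) × (Q w → P w)

  _⊆ᶜ_ : (V → Set₁) → (V → Set₁) → Set₁
  P ⊆ᶜ Q = (w : V) → P w → Q w

{-# OPTIONS --safe #-}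
-- A magma x is a set with x ⊆ x, so x ∈ pr(x); and the only sets in pr(y) are
-- subsets of y, since pr of an atom contains nothing but atoms. Hence pr(x) ⊆ pr(y)
-- forces x ⊆ y, which with extensionality gives (i) and (ii); (iii) holds because
-- pr(x) contains the set x, and (iv) only uses reflexivity and transitivity of ≼.
module Submission where

open import Defs
open import Data.Product using (Σ-syntax; _×_; _,_; proj₁; proj₂)
open import Data.Sum using (inj₁; inj₂)
open import Data.Empty using (⊥-elim)
open import Level using (lift)
open import Relation.Nullary using (¬_)
open import Relation.Binary.PropositionalEquality using (_≡_; refl; sym)
open import Relation.Binary.Definitions using (Reflexive; Transitive)
open import Relation.Binary.Structures using (IsPreorder)

module Properties (A : Set) (_≼_ : A → A → Set) where
  open ZFA A _≼_

  ≐-refl : ∀ x → x ≐ x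
  ≐-refl (atom a)  = refl
  ≐-refl (sup I f) = (λ i → i , ≐-refl (f i)) , (λ j → j , ≐-refl (f j))

  ≐-sym : ∀ {x y} → x ≐ y → y ≐ x
  ≐-sym {atom a}  {atom b}  e       = sym e
  ≐-sym {sup I f} {sup J g} (p , q) =
    (λ j → proj₁ (q j) , ≐-sym (proj₂ (q j))) ,
    (λ i → proj₁ (p i) , ≐-sym (proj₂ (p i)))

  ∈-self : ∀ {I} (f : I → V) (i : I) → f i ∈ sup I f
  ∈-self f i = i , ≐-refl (f i)

  ⊆-refl : ∀ x → x ⊆ x
  ⊆-refl x z z∈x = z∈x

  ⊆-antisym : ∀ {x y} → IsSet x → IsSet y → x ⊆ y → y ⊆ x → x ≐ y
  ⊆-antisym {sup I f} {sup J g} _ _ x⊆y y⊆x =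
    (λ i → x⊆y (f i) (∈-self f i)) ,
    (λ j → let (i , gj≐fi) = y⊆x (g j) (∈-self g j) in i , ≐-sym gj≐fi)

  Lev⇒IsSet  : ∀ α {x} → Lev α x → IsSet x
  Upto⇒IsSet : ∀ α {x} → Upto α x → IsSet x
  Lev⇒IsSet one       (s , _) = s
  Lev⇒IsSet (succ α)  (s , _) = s
  Lev⇒IsSet (lim I f) (i , u) = Upto⇒IsSet (f i) u
  Upto⇒IsSet one       (s , _)        = s
  Upto⇒IsSet (succ α)  (inj₁ u)       = Upto⇒IsSet α u
  Upto⇒IsSet (succ α)  (inj₂ (s , _)) = s
  Upto⇒IsSet (lim I f) (i , u)        = Upto⇒IsSet (f i) u

  IsMagma⇒IsSet : ∀ {x} → IsMagma x → IsSet x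
  IsMagma⇒IsSet (α , _ , x∈Mα) = Lev⇒IsSet α x∈Mα

  ∈pr-self : ∀ {x} → IsMagma x → pr x x
  ∈pr-self {atom a}  m with () ← IsMagma⇒IsSet m
  ∈pr-self {sup I f} m = m , ⊆-refl (sup I f)

  pr-atom-has-no-sets : ∀ {a x} → IsSet x → ¬ pr (atom a) x
  pr-atom-has-no-sets {x = sup I f} _ (_ , lift () , _)

  pr⇒⊆ : ∀ {x y} → IsSet x → pr y x → x ⊆ y
  pr⇒⊆ {y = atom a}  x-set x∈pr = ⊥-elim (pr-atom-has-no-sets x-set x∈pr)
  pr⇒⊆ {y = sup J g} _     x∈pr = proj₂ x∈pr

  ≡ᶜ⇒⊆ᶜ : ∀ {P Q} → P ≡ᶜ Q → P ⊆ᶜ Q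
  ≡ᶜ⇒⊆ᶜ P≡Q w = proj₁ (P≡Q w)

  ≡ᶜ⇒⊇ᶜ : ∀ {P Q} → P ≡ᶜ Q → Q ⊆ᶜ P
  ≡ᶜ⇒⊇ᶜ P≡Q w = proj₂ (P≡Q w)

  ⊆ᶜ-antisym : ∀ {P Q} → P ⊆ᶜ Q → Q ⊆ᶜ P → P ≡ᶜ Q
  ⊆ᶜ-antisym P⊆Q Q⊆P w = P⊆Q w , Q⊆P w

  pr-mono : ∀ {x y} → IsSet x → IsSet y → x ⊆ y → pr x ⊆ᶜ pr y
  pr-mono {sup I f} {sup J g} _ _ x⊆y w (w-magma , w⊆x) =
    w-magma , λ z z∈w → x⊆y z (w⊆x z z∈w)

  pr-reflects-⊆ : ∀ {x y} → IsMagma x → pr x ⊆ᶜ pr y → x ⊆ y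
  pr-reflects-⊆ {x} x-magma prx⊆pry =
    pr⇒⊆ (IsMagma⇒IsSet x-magma) (prx⊆pry x (∈pr-self x-magma))

  pr-injective : ∀ {x y} → IsMagma x → IsMagma y → pr x ≡ᶜ pr y → x ≐ y
  pr-injective x-magma y-magma prx≡pry =
    ⊆-antisym (IsMagma⇒IsSet x-magma) (IsMagma⇒IsSet y-magma)
      (pr-reflects-⊆ x-magma (≡ᶜ⇒⊆ᶜ prx≡pry))
      (pr-reflects-⊆ y-magma (≡ᶜ⇒⊇ᶜ prx≡pry))

  pr-atom≢pr-magma : ∀ {a x} → IsMagma x → ¬ (pr (atom a) ≡ᶜ pr x)
  pr-atom≢pr-magma {x = x} x-magma pra≡prx =
    pr-atom-has-no-sets (IsMagma⇒IsSet x-magma) (≡ᶜ⇒⊇ᶜ pra≡prx x (∈pr-self x-magma))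

  pr-atom-mono : Transitive _≼_ → ∀ {a b} → a ≼ b → pr (atom a) ⊆ᶜ pr (atom b)
  pr-atom-mono ≼-trans a≼b w (c , w≐c , lift c≼a) = c , w≐c , lift (≼-trans c≼a a≼b)

  pr-atom-reflects-≼ : Reflexive _≼_ → ∀ {a b} → pr (atom a) ⊆ᶜ pr (atom b) → a ≼ b
  pr-atom-reflects-≼ ≼-refl {a} pra⊆prb with pra⊆prb (atom a) (a , lift refl , lift ≼-refl)
  ... | _ , lift refl , lift a≼b = a≼b

lemma2p3 : (A : Set) (_≼_ : A → A → Set)
    → IsPreorder _≡_ _≼_
    → ((a : A) → Σ[ b ∈ A ] ((b ≼ a) × ¬ (a ≼ b)))
    → let open ZFA A _≼_ in
      ((x y : V) → IsMagma x → IsMagma y → pr x ≡ᶜ pr y → x ≐ y)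
      × ((x y : V) → IsMagma x → IsMagma y → (x ⊆ y → pr x ⊆ᶜ pr y) × (pr x ⊆ᶜ pr y → x ⊆ y))
      × ((a : A) (x : V) → IsMagma x → ¬ (pr (atom a) ≡ᶜ pr x))
      × ((a b : A) → (pr (atom a) ≡ᶜ pr (atom b) → (a ≼ b) × (b ≼ a)) × ((a ≼ b) × (b ≼ a) → pr (atom a) ≡ᶜ pr (atom b)))
lemma2p3 A _≼_ ≼-isPreorder _ =
  (λ _ _ → pr-injective) ,
  (λ _ _ x-magma y-magma →
      pr-mono (IsMagma⇒IsSet x-magma) (IsMagma⇒IsSet y-magma) , pr-reflects-⊆ x-magma) ,
  (λ _ _ → pr-atom≢pr-magma) ,
  (λ _ _ →
      (λ pra≡prb → pr-atom-reflects-≼ ≼-refl (≡ᶜ⇒⊆ᶜ pra≡prb) , pr-atom-reflects-≼ ≼-refl (≡ᶜ⇒⊇ᶜ pra≡prb)) ,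
      (λ (a≼b , b≼a) → ⊆ᶜ-antisym (pr-atom-mono ≼-trans a≼b) (pr-atom-mono ≼-trans b≼a)))
  where
    open Properties A _≼_
    open IsPreorder ≼-isPreorder using () renaming (refl to ≼-refl; trans to ≼-trans)
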